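{- Let $F$ be a $k$-CNF formula and let $\pi$ be an $r$-DNF resolution refutation of $F$ with space at most $s$. Then there exists a resolution refutation $\pi'$ of $F$ of width at most $(s-2)r + k - 1$.
   Context: A literal is a variable $x$ or its negation $\overline{x}$. A clause is a disjunction of literals, a term a conjunction of literals; an $r$-term has at most $r$ literals; a $k$-CNF formula is a conjunction of clauses with at most $k$ literals each (assumed not to contain the empty clause $0$); an $r$-DNF formula is a disjunction of $r$-terms. An $r$-DNF resolution refutation of a CNF formula $F$ is a sequence of configurations (sets of $r$-DNF formulas) $(\mathbb{C}_0,\dots,\mathbb{C}_\tau)$ with $\mathbb{C}_0=\emptyset$, $0\in\mathbb{C}_\tau$, and each $\mathbb{C}_t$ obtained from $\mathbb{C}_{t-1}$ by: axiom download ($\mathbb{C}_t=\mathbb{C}_{t-1}\cup\{A\}$ for a clause $A$ of $F$); inference ($\mathbb{C}_t=\mathbb{C}_{t-1}\cup\{D\}$ where $D$ follows from formulas in $\mathbb{C}_{t-1}$ by one of the rules, with $G,H$ $r$-DNF formulas, $T,T'$ $r$-terms and $a_i$ literals: $r$-cut: from $(a_1\land\cdots\land a_{r'})\lor G$ and $\overline{a}_1\lor\cdots\lor\overline{a}_{r'}\lor H$ with $r'\le r$ infer $G\lor H$; $\land$-introduction: from $G\lor T$ and $G\lor T'$ infer $G\lor(T\land T')$ provided $|T\cup T'|\le r$; $\land$-elimination: from $G\lor T$ infer $G\lor T'$ for nonempty $T'\subseteq T$; weakening: from $G$ infer $G\lor H$); or erasure ($\mathbb{C}_t=\mathbb{C}_{t-1}\setminus\{C\}$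 for some $C\in\mathbb{C}_{t-1}$). The space of the refutation is the maximum number of formulas in any configuration. For $r=1$ this is (standard) resolution, whose essential rule is: from $C\lor x$ and $D\lor\overline{x}$ infer $C\lor D$ (plus weakening). The width of a resolution refutation is the maximum number of literals in any clause appearing in it. -}

module Defs where

open import Data.Nat using (ℕ; zero; suc; _≤_; _⊔_; _≟_)
open import Data.Bool using (Bool; true; false)
open import Data.List using (List; []; _∷_; _++_; length; map; foldr; deduplicate; [_])
open import Data.List.Membership.Propositional using (_∈_)
open import Data.List.Relation.Unary.All using (All)
open import Data.Product using (Σ; ∃; _×_; _,_)
open import Relation.Nullary using (¬_; Dec; yes; no)
open import Relation.Binary.PropositionalEquality using (_≡_; refl; cong)
open import Relation.Binary.Definitions using (DecidableEquality)

data Lit : Set where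
  pos : ℕ → Lit
  neg : ℕ → Lit

negate : Lit → Lit
negate (pos x) = neg x
negate (neg x) = pos x

_≟L_ : DecidableEquality Lit
pos x ≟L pos y with x ≟ y
... | yes refl = yes refl
... | no x≢y = no λ { refl → x≢y refl }
pos x ≟L neg y = no λ ()
neg x ≟L pos y = no λ ()
neg x ≟L neg y with x ≟ y
... | yes refl = yes refl
... | no x≢y = no λ { refl → x≢y refl }

-- Clauses and terms are SETS of literals, represented by lists;
-- equality of such sets is mutual inclusion, and the number of
-- literals is the number of distinct entries.

Clause : Set
Clause = List Lit

Term : Set
Term = List Lit

size : List Lit → ℕ
size xs = length (deduplicate _≟L_ xs)

_⊆L_ : List Lit → List Lit → Set
xs ⊆L ys = ∀ {a} → a ∈ xs → a ∈ ys

_≈L_ : List Lit → List Lit → Set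
xs ≈L ys = (xs ⊆L ys) × (ys ⊆L xs)

CNF : Set
CNF = List Clause

IsKCNF : ℕ → CNF → Set
IsKCNF k F = All (λ C → (size C ≤ k) × ¬ (C ≡ [])) F

DNF : Set
DNF = List Term

_⊑_ : DNF → DNF → Set
G ⊑ H = ∀ {T} → T ∈ G → ∃ λ T' → (T' ∈ H) × (T ≈L T')

_≋_ : DNF → DNF → Set
G ≋ H = (G ⊑ H) × (H ⊑ G)

IsRDNF : ℕ → DNF → Set
IsRDNF r G = All (λ T → size T ≤ r) G

clauseDNF : Clause → DNF
clauseDNF C = map [_] C

negTermDNF : Term → DNF
negTermDNF T = map (λ a → [ negate a ]) T

Config : Set
Config = List DNF

data Inference (r : ℕ) (𝒞 : Config) (D : DNF) : Set where
  cut : ∀ {P Q} (T : Term) (G H : DNF) →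
        P ∈ 𝒞 → Q ∈ 𝒞 →
        ¬ (T ≡ []) → size T ≤ r →
        P ≋ (T ∷ G) → Q ≋ (negTermDNF T ++ H) →
        D ≋ (G ++ H) → Inference r 𝒞 D
  ∧-intro : ∀ {P Q} (T T' : Term) (G : DNF) →
        P ∈ 𝒞 → Q ∈ 𝒞 →
        P ≋ (T ∷ G) → Q ≋ (T' ∷ G) →
        size (T ++ T') ≤ r →
        D ≋ ((T ++ T') ∷ G) → Inference r 𝒞 D
  ∧-elim : ∀ {P} (T T' : Term) (G : DNF) →
        P ∈ 𝒞 →
        P ≋ (T ∷ G) →
        ¬ (T' ≡ []) → T' ⊆L T →
        D ≋ (T' ∷ G) → Inference r 𝒞 D
  weaken : ∀ {P} (H : DNF) →
        P ∈ 𝒞 →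
        D ≋ (P ++ H) → Inference r 𝒞 D

data Step (F : CNF) (r : ℕ) : Config → Config → Set where
  download : ∀ {𝒞} (A : Clause) → A ∈ F → Step F r 𝒞 (clauseDNF A ∷ 𝒞)
  infer : ∀ {𝒞} (D : DNF) → IsRDNF r D → Inference r 𝒞 D → Step F r 𝒞 (D ∷ 𝒞)
  erase : ∀ (xs : Config) (C : DNF) (ys : Config) → Step F r (xs ++ C ∷ ys) (xs ++ ys)

data Chain (F : CNF) (r : ℕ) : Config → List Config → Set where
  stop : ∀ {𝒞} → Chain F r 𝒞 []
  next : ∀ {𝒞 𝒞' cs} → Step F r 𝒞 𝒞' → Chain F r 𝒞' cs → Chain F r 𝒞 (𝒞' ∷ cs)

lastConfig : Config → List Config → Config
lastConfig 𝒞 [] = 𝒞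
lastConfig 𝒞 (𝒞' ∷ cs) = lastConfig 𝒞' cs

record DNFRefutation (F : CNF) (r : ℕ) : Set where
  field
    rest    : List Config
    chain   : Chain F r [] rest
    refutes : [] ∈ lastConfig [] rest

  configs : List Config
  configs = [] ∷ rest

space : ∀ {F r} → DNFRefutation F r → ℕ
space π = foldr _⊔_ 0 (map length (DNFRefutation.configs π))

data ResDeriv (F : CNF) (w : ℕ) : Clause → Set where
  axiom   : ∀ {A} → A ∈ F → size A ≤ w → ResDeriv F w A
  resolve : ∀ {C₁ C₂ E} (x : Lit) (C D : Clause) →
            ResDeriv F w C₁ → ResDeriv F w C₂ →
            C₁ ≈L (x ∷ C) → C₂ ≈L (negate x ∷ D) →
            E ≈L (C ++ D) → size E ≤ w → ResDeriv F w E
  weaken  : ∀ {C E} → ResDeriv F w C → C ⊆L E → size E ≤ w → ResDeriv F w E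

ResRefutationOfWidth≤ : CNF → ℕ → Set
ResRefutationOfWidth≤ F w = ResDeriv F w []

-- Read the refutation backwards. Call a consistent set of literals ρ good for a configuration 𝒞
-- if every formula of 𝒞 has an r-term contained in ρ. For every configuration and every good ρ
-- with |ρ| ≤ (s − 2)r + 1, the clause ¬ρ has a resolution derivation of width (s − 2)r + k − 1;
-- for the initial configuration and the empty ρ this is the refutation. Nothing is good for the
-- last configuration, which contains 0, and erasures and inferences preserve goodness by
-- soundness. At the download of A into 𝒞, shrink ρ to the at most |𝒞|r literals witnessing 𝒞:
-- for each a ∈ A not in ¬ρ, ρ ∪ {a} is good after the download, so ¬ρ ∨ ¬a is derivable, and
-- resolving these against A gives ¬ρ. A download that fills the memory is followed by an erasure
-- and simulated together with it, so |𝒞| ≤ s − 2 at every simulated download.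
--
-- Every refutation has r ≥ 1 and a configuration of three formulas (around the final cut), so
-- (s − 2)r ≥ 1. For k ≤ 1 the final weakening to ¬ρ does not fit in the width, but then F contains
-- complementary unit clauses, since otherwise the literals of F would satisfy it.

module Submission where

open import Defs
open import Data.Empty using (⊥-elim)
open import Data.List using (List; []; _∷_; _++_; [_]; length; map; filter; concat; deduplicate)
open import Data.List.Membership.DecPropositional _≟L_ using (_∈?_)
open import Data.List.Membership.Propositional using (_∈_; _∉_; find; lose)
open import Data.List.Membership.Propositional.Properties
  using (∈-++⁺ˡ; ∈-++⁺ʳ; ∈-++⁻; ∈-map⁺; ∈-map⁻; ∈-filter⁺; ∈-filter⁻; ∈-deduplicate⁺; ∈-deduplicate⁻;
         ∈-concat⁺′; ∈-concat⁻′; ∈-length)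
open import Data.List.Properties using (length-++; length-map; length-deduplicate; filter-notAll; foldr-forcesᵇ)
open import Data.List.Relation.Binary.Subset.Propositional using (_⊆_)
open import Data.List.Relation.Binary.Subset.Propositional.Properties
  using (⊆-refl; ⊆-trans; xs⊆xs++ys; xs⊆ys++xs; xs⊆x∷xs; ++⁺; ++⁺ʳ; map⁺; ∈-∷⁺ʳ; ⊆∷∧∉⇒⊆)
open import Data.List.Relation.Unary.All as All using (All; []; _∷_)
open import Data.List.Relation.Unary.All.Properties using (anti-mono; map⁻)
open import Data.List.Relation.Unary.AllPairs using ([]; _∷_)
open import Data.List.Relation.Unary.Any as Any using (Any; here; there; any?)
open import Data.List.Relation.Unary.Unique.Propositional using (Unique)
open import Data.List.Relation.Unary.Unique.DecPropositional.Properties _≟L_ using (deduplicate-!)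
open import Data.Nat using (ℕ; suc; _≤_; _<_; _+_; _*_; _∸_; z≤n; s≤s; s≤s⁻¹; _≤?_)
open import Data.Nat.Properties
open import Data.Product using (∃; ∃₂; _×_; _,_; proj₁; proj₂; map₂)
open import Data.Sum as Sum using (_⊎_; inj₁; inj₂; [_,_]′)
open import Function using (_∘_; id)
open import Relation.Nullary using (¬_; Dec; yes; no; ¬?)
open import Relation.Binary.Definitions using (DecidableEquality)
open import Relation.Binary.PropositionalEquality using (_≡_; _≢_; refl; sym; cong; subst; module ≡-Reasoning)

private
  variable
    a : Lit
    ρ ρ′ xs ys zs : List Lit
    T : Term
    P Q D G H : DNF
    𝒞 𝒞′ : Config
    cs : List Config
    F : CNF
    k r s w : ℕ

Unique∧⊆⇒length≤ : ∀ {A : Set} (_≟_ : DecidableEquality A) {us vs : List A} →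
                   Unique us → us ⊆ vs → length us ≤ length vs
Unique∧⊆⇒length≤ _≟_ {[]} _ _ = z≤n
Unique∧⊆⇒length≤ _≟_ {u ∷ us} {vs} (u∉us ∷ us!) u∷us⊆vs = begin-strict
  length us                        ≤⟨ Unique∧⊆⇒length≤ _≟_ us! us⊆vs-u ⟩
  length (filter (¬? ∘ (u ≟_)) vs) <⟨ filter-notAll (¬? ∘ (u ≟_)) vs u∈vs ⟩
  length vs                        ∎
  where
  open ≤-Reasoning
  us⊆vs-u : us ⊆ filter (¬? ∘ (u ≟_)) vs
  us⊆vs-u v∈us = ∈-filter⁺ (¬? ∘ (u ≟_)) (u∷us⊆vs (there v∈us)) (All.lookup u∉us v∈us)
  u∈vs = Any.map (λ u≡v u≢v → u≢v u≡v) (u∷us⊆vs (here refl))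

⊆-deduplicate : ∀ xs → xs ⊆ deduplicate _≟L_ xs
⊆-deduplicate _ = ∈-deduplicate⁺ _≟L_

size-mono : xs ⊆ ys → size xs ≤ size ys
size-mono {xs} {ys} xs⊆ys =
  Unique∧⊆⇒length≤ _≟L_ (deduplicate-! xs) (⊆-deduplicate ys ∘ xs⊆ys ∘ ∈-deduplicate⁻ _≟L_ xs)

size≤length : ∀ xs → size xs ≤ length xs
size≤length = length-deduplicate _≟L_

size-++ : ∀ xs ys → size (xs ++ ys) ≤ size xs + size ys
size-++ xs ys = begin
  size (xs ++ ys)         ≤⟨ size-mono (++⁺ (⊆-deduplicate xs) (⊆-deduplicate ys)) ⟩
  size (dd xs ++ dd ys)   ≤⟨ size≤length (dd xs ++ dd ys) ⟩
  length (dd xs ++ dd ys) ≡⟨ length-++ (dd xs) ⟩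
  size xs + size ys       ∎
  where
  open ≤-Reasoning
  dd = deduplicate _≟L_

size-∷ : ∀ a xs → size (a ∷ xs) ≤ suc (size xs)
size-∷ a = size-++ [ a ]

size-map : ∀ (f : Lit → Lit) xs → size (map f xs) ≤ size xs
size-map f xs = begin
  size (map f xs)        ≤⟨ size-mono (map⁺ f (⊆-deduplicate xs)) ⟩
  size (map f (dd xs))   ≤⟨ size≤length (map f (dd xs)) ⟩
  length (map f (dd xs)) ≡⟨ length-map f (dd xs) ⟩
  size xs                ∎
  where
  open ≤-Reasoning
  dd = deduplicate _≟L_

size≤1⇒≈singleton : size xs ≤ 1 → a ∈ xs → xs ≈L [ a ]
size≤1⇒≈singleton {xs} {a} |xs|≤1 a∈xs = xs⊆[a] , λ { (here refl) → a∈xs }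
  where
  xs⊆[a] : xs ⊆ [ a ]
  xs⊆[a] {b} b∈xs with a ≟L b
  ... | yes refl = here refl
  ... | no a≢b = ⊥-elim (1+n≰n (≤-trans (Unique∧⊆⇒length≤ _≟L_ ((a≢b ∷ []) ∷ [] ∷ []) ab⊆xs) |xs|≤1))
    where
    ab⊆xs : a ∷ b ∷ [] ⊆ deduplicate _≟L_ xs
    ab⊆xs (here refl)         = ⊆-deduplicate xs a∈xs
    ab⊆xs (there (here refl)) = ⊆-deduplicate xs b∈xs

++-⊆ : xs ⊆ zs → ys ⊆ zs → xs ++ ys ⊆ zs
++-⊆ {xs} xs⊆zs ys⊆zs = [ xs⊆zs , ys⊆zs ]′ ∘ ∈-++⁻ xs

erase-⊆ : ∀ {A : Set} (xs : List A) {C ys} → xs ++ ys ⊆ xs ++ C ∷ ys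
erase-⊆ xs {C} {ys} = ++⁺ʳ xs (xs⊆x∷xs ys C)

length-erase : ∀ {A : Set} (xs : List A) {C ys} → length (xs ++ C ∷ ys) ≡ suc (length (xs ++ ys))
length-erase []       = refl
length-erase (_ ∷ xs) = cong suc (length-erase xs)

distinct⇒2≤length : ∀ {A : Set} {x y : A} {zs} → x ∈ zs → y ∈ zs → x ≢ y → 2 ≤ length zs
distinct⇒2≤length (here refl) (here refl) x≢y = ⊥-elim (x≢y refl)
distinct⇒2≤length (here _)    (there y∈)  _   = s≤s (∈-length y∈)
distinct⇒2≤length (there x∈)  _           _   = s≤s (∈-length x∈)

negate-involutive : ∀ a → negate (negate a) ≡ a
negate-involutive (pos _) = refl
negate-involutive (neg _) = refl

a≢negate[a] : ∀ a → a ≢ negate a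
a≢negate[a] (pos _) ()
a≢negate[a] (neg _) ()

-- An assignment is the list of the literals it makes true.
Assignment : Set
Assignment = List Lit

Consistent : Assignment → Set
Consistent ρ = ∀ {a} → a ∈ ρ → negate a ∉ ρ

_⊨_ : Assignment → DNF → Set
ρ ⊨ P = ∃ λ T → T ∈ P × T ⊆ ρ

_⊨[_]_ : Assignment → ℕ → DNF → Set
ρ ⊨[ r ] P = ∃ λ T → (T ∈ P × size T ≤ r) × T ⊆ ρ

consistent-⊆ : ρ′ ⊆ ρ → Consistent ρ → Consistent ρ′
consistent-⊆ ρ′⊆ρ ρ-consistent a∈ρ′ ¬a∈ρ′ = ρ-consistent (ρ′⊆ρ a∈ρ′) (ρ′⊆ρ ¬a∈ρ′)

consistent-∷ : Consistent ρ → negate a ∉ ρ → Consistent (a ∷ ρ)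
consistent-∷ {a = a} _ _    (here refl) (here ¬a≡a)  = a≢negate[a] a (sym ¬a≡a)
consistent-∷ _ ¬a∉ρ         (here refl) (there ¬a∈ρ) = ¬a∉ρ ¬a∈ρ
consistent-∷ _ ¬a∉ρ         (there b∈ρ) (here refl)  = ¬a∉ρ (subst (_∈ _) (sym (negate-involutive _)) b∈ρ)
consistent-∷ ρ-consistent _ (there b∈ρ) (there ¬b∈ρ) = ρ-consistent b∈ρ ¬b∈ρ

⊨-resp-⊑ : P ⊑ Q → ρ ⊨ P → ρ ⊨ Q
⊨-resp-⊑ P⊑Q (T , T∈P , T⊆ρ) with P⊑Q T∈P
... | T′ , T′∈Q , _ , T′⊆T = T′ , T′∈Q , T⊆ρ ∘ T′⊆T

⊨[]-mono : ρ ⊆ ρ′ → ρ ⊨[ r ] P → ρ′ ⊨[ r ] P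
⊨[]-mono ρ⊆ρ′ (T , T∈P , T⊆ρ) = T , T∈P , ρ⊆ρ′ ∘ T⊆ρ

⊨[]⇒⊨ : ρ ⊨[ r ] P → ρ ⊨ P
⊨[]⇒⊨ (T , (T∈P , _) , T⊆ρ) = T , T∈P , T⊆ρ

⊭0 : ¬ (ρ ⊨ [])
⊭0 (_ , () , _)

⊨-++⁺ˡ : ρ ⊨ G → ρ ⊨ (G ++ H)
⊨-++⁺ˡ (T , T∈G , T⊆ρ) = T , ∈-++⁺ˡ T∈G , T⊆ρ

⊨-++⁺ʳ : ∀ G → ρ ⊨ H → ρ ⊨ (G ++ H)
⊨-++⁺ʳ G (T , T∈H , T⊆ρ) = T , ∈-++⁺ʳ G T∈H , T⊆ρ

⊨-∷⁺ʳ : ρ ⊨ G → ρ ⊨ (T ∷ G)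
⊨-∷⁺ʳ (T , T∈G , T⊆ρ) = T , there T∈G , T⊆ρ

⊨-∷⁻ : ρ ⊨ (T ∷ G) → T ⊆ ρ ⊎ ρ ⊨ G
⊨-∷⁻ (_ , here refl , T⊆ρ) = inj₁ T⊆ρ
⊨-∷⁻ (T , there T∈G , T⊆ρ) = inj₂ (T , T∈G , T⊆ρ)

⊨-++⁻ : ∀ G → ρ ⊨ (G ++ H) → ρ ⊨ G ⊎ ρ ⊨ H
⊨-++⁻ G (T , T∈G++H , T⊆ρ) = Sum.map (λ T∈G → T , T∈G , T⊆ρ) (λ T∈H → T , T∈H , T⊆ρ) (∈-++⁻ G T∈G++H)

⊭negTermDNF : Consistent ρ → T ⊆ ρ → ¬ (ρ ⊨ negTermDNF T)
⊭negTermDNF ρ-consistent T⊆ρ (T′ , T′∈¬T , T′⊆ρ) with ∈-map⁻ (λ a → [ negate a ]) T′∈¬T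
... | a , a∈T , refl = ρ-consistent (T⊆ρ a∈T) (T′⊆ρ (here refl))

premise-true : All (ρ ⊨_) 𝒞 → P ∈ 𝒞 → P ≋ Q → ρ ⊨ Q
premise-true ρ⊨𝒞 P∈𝒞 P≋Q = ⊨-resp-⊑ (proj₁ P≋Q) (All.lookup ρ⊨𝒞 P∈𝒞)

inference-sound : Consistent ρ → All (ρ ⊨_) 𝒞 → Inference r 𝒞 D → ρ ⊨ D
inference-sound ρ-consistent ρ⊨𝒞 (cut T G H P∈𝒞 Q∈𝒞 _ _ P≋ Q≋ D≋) with ⊨-∷⁻ (premise-true ρ⊨𝒞 P∈𝒞 P≋)
... | inj₂ ρ⊨G = ⊨-resp-⊑ (proj₂ D≋) (⊨-++⁺ˡ ρ⊨G)
... | inj₁ T⊆ρ with ⊨-++⁻ (negTermDNF T) (premise-true ρ⊨𝒞 Q∈𝒞 Q≋)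
...   | inj₁ ρ⊨¬T = ⊥-elim (⊭negTermDNF ρ-consistent T⊆ρ ρ⊨¬T)
...   | inj₂ ρ⊨H  = ⊨-resp-⊑ (proj₂ D≋) (⊨-++⁺ʳ G ρ⊨H)
inference-sound _ ρ⊨𝒞 (∧-intro T T′ G P∈𝒞 Q∈𝒞 P≋ Q≋ _ D≋)
  with ⊨-∷⁻ (premise-true ρ⊨𝒞 P∈𝒞 P≋) | ⊨-∷⁻ (premise-true ρ⊨𝒞 Q∈𝒞 Q≋)
... | inj₁ T⊆ρ | inj₁ T′⊆ρ = ⊨-resp-⊑ (proj₂ D≋) (T ++ T′ , here refl , ++-⊆ T⊆ρ T′⊆ρ)
... | inj₂ ρ⊨G | _         = ⊨-resp-⊑ (proj₂ D≋) (⊨-∷⁺ʳ ρ⊨G)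
... | _        | inj₂ ρ⊨G  = ⊨-resp-⊑ (proj₂ D≋) (⊨-∷⁺ʳ ρ⊨G)
inference-sound _ ρ⊨𝒞 (∧-elim T T′ G P∈𝒞 P≋ _ T′⊆T D≋) with ⊨-∷⁻ (premise-true ρ⊨𝒞 P∈𝒞 P≋)
... | inj₁ T⊆ρ = ⊨-resp-⊑ (proj₂ D≋) (T′ , here refl , T⊆ρ ∘ T′⊆T)
... | inj₂ ρ⊨G = ⊨-resp-⊑ (proj₂ D≋) (⊨-∷⁺ʳ ρ⊨G)
inference-sound _ ρ⊨𝒞 (weaken H P∈𝒞 D≋) = ⊨-resp-⊑ (proj₂ D≋) (⊨-++⁺ˡ (All.lookup ρ⊨𝒞 P∈𝒞))

chain-sound : Consistent ρ → (∀ {A} → A ∈ F → ρ ⊨ clauseDNF A) →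
              Chain F r 𝒞 cs → All (ρ ⊨_) 𝒞 → All (ρ ⊨_) (lastConfig 𝒞 cs)
chain-sound _ _ stop ρ⊨𝒞 = ρ⊨𝒞
chain-sound ρ-consistent ρ⊨F (next (download _ A∈F) ch) ρ⊨𝒞 =
  chain-sound ρ-consistent ρ⊨F ch (ρ⊨F A∈F ∷ ρ⊨𝒞)
chain-sound ρ-consistent ρ⊨F (next (infer _ _ inf) ch) ρ⊨𝒞 =
  chain-sound ρ-consistent ρ⊨F ch (inference-sound ρ-consistent ρ⊨𝒞 inf ∷ ρ⊨𝒞)
chain-sound ρ-consistent ρ⊨F (next (erase xs _ _) ch) ρ⊨𝒞 =
  chain-sound ρ-consistent ρ⊨F ch (anti-mono (erase-⊆ xs) ρ⊨𝒞)

IsKCNF⇒[]∉ : IsKCNF k F → [] ∉ F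
IsKCNF⇒[]∉ F-kcnf []∈F = proj₂ (All.lookup F-kcnf []∈F) refl

download-∋[] : ∀ {A} → [] ∉ F → A ∈ F → [] ∈ clauseDNF A ∷ 𝒞 → [] ∈ 𝒞
download-∋[] {A = []}    []∉F A∈F _           = ⊥-elim ([]∉F A∈F)
download-∋[] {A = _ ∷ _} _    _   (here ())
download-∋[] {A = _ ∷ _} _    _   (there 0∈𝒞) = 0∈𝒞

[]≭∷ : ¬ ([] ≋ (T ∷ G))
[]≭∷ (_ , T∷G⊑[]) with T∷G⊑[] (here refl)
... | _ , () , _

cut-premises-distinct : T ≢ [] → P ≋ (T ∷ []) → Q ≋ (negTermDNF T ++ []) → P ≢ Q
cut-premises-distinct {[]} T≢[] _ _ _ = T≢[] refl
cut-premises-distinct {a ∷ T} _ P≋T (_ , ¬T⊑P) refl with ¬T⊑P (here refl)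
... | T′ , T′∈P , _ , T′⊆[¬a] with proj₁ P≋T T′∈P
...   | _ , here refl , _ , a∷T⊆T′ with T′⊆[¬a] (a∷T⊆T′ (here refl))
...     | here a≡¬a = a≢negate[a] a a≡¬a

inference-of-0 : Inference r 𝒞 [] → [] ∉ 𝒞 → 1 ≤ r × 2 ≤ length 𝒞
inference-of-0 (cut T (_ ∷ _) _ _ _ _ _ _ _ 0≋) _ = ⊥-elim ([]≭∷ 0≋)
inference-of-0 (cut T [] (_ ∷ _) _ _ _ _ _ _ 0≋) _ = ⊥-elim ([]≭∷ 0≋)
inference-of-0 (cut [] [] [] _ _ T≢[] _ _ _ _) _ = ⊥-elim (T≢[] refl)
inference-of-0 (cut (a ∷ T) [] [] P∈𝒞 Q∈𝒞 T≢[] |T|≤r P≋ Q≋ _) _ =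
  ≤-trans (s≤s z≤n) |T|≤r , distinct⇒2≤length P∈𝒞 Q∈𝒞 (cut-premises-distinct T≢[] P≋ Q≋)
inference-of-0 (∧-intro _ _ _ _ _ _ _ _ 0≋) _ = ⊥-elim ([]≭∷ 0≋)
inference-of-0 (∧-elim _ _ _ _ _ _ _ 0≋) _ = ⊥-elim ([]≭∷ 0≋)
inference-of-0 (weaken {P = _ ∷ _} _ _ 0≋) _ = ⊥-elim ([]≭∷ 0≋)
inference-of-0 (weaken {P = []} _ 0∈𝒞 _) 0∉𝒞 = ⊥-elim (0∉𝒞 0∈𝒞)

deriving-0⇒1≤r×3≤length : [] ∉ F → Chain F r 𝒞 cs → [] ∉ 𝒞 → [] ∈ lastConfig 𝒞 cs →
                           1 ≤ r × Any (λ 𝒞′ → 3 ≤ length 𝒞′) cs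
deriving-0⇒1≤r×3≤length _ stop 0∉𝒞 0∈𝒞 = ⊥-elim (0∉𝒞 0∈𝒞)
deriving-0⇒1≤r×3≤length []∉F (next (download _ A∈F) ch) 0∉𝒞 0∈ =
  map₂ there (deriving-0⇒1≤r×3≤length []∉F ch (0∉𝒞 ∘ download-∋[] []∉F A∈F) 0∈)
deriving-0⇒1≤r×3≤length _ (next (infer [] _ inf) _) 0∉𝒞 _ =
  map₂ (here ∘ s≤s) (inference-of-0 inf 0∉𝒞)
deriving-0⇒1≤r×3≤length []∉F (next (infer (_ ∷ _) _ _) ch) 0∉𝒞 0∈ =
  map₂ there (deriving-0⇒1≤r×3≤length []∉F ch (λ { (here ()) ; (there 0∈𝒞) → 0∉𝒞 0∈𝒞 }) 0∈)
deriving-0⇒1≤r×3≤length []∉F (next (erase xs _ _) ch) 0∉𝒞 0∈ =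
  map₂ there (deriving-0⇒1≤r×3≤length []∉F ch (0∉𝒞 ∘ erase-⊆ xs) 0∈)

space≤⇒length≤ : (π : DNFRefutation F r) → space π ≤ s →
                 All (λ 𝒞 → length 𝒞 ≤ s) (DNFRefutation.configs π)
space≤⇒length≤ π =
  map⁻ ∘ foldr-forcesᵇ (λ m n m⊔n≤s → m⊔n≤o⇒m≤o m n m⊔n≤s , m⊔n≤o⇒n≤o m n m⊔n≤s) 0 _

complementary-units : k ≤ 1 → IsKCNF k F → Chain F r [] cs → [] ∈ lastConfig [] cs →
                      ∃₂ λ A B → A ∈ F × B ∈ F × ∃ λ a → A ≈L [ a ] × B ≈L [ negate a ]
complementary-units {F = F} k≤1 F-kcnf ch 0∈ with any? (λ a → negate a ∈? concat F) (concat F)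
... | yes clash =
  let a , a∈F , ¬a∈F = find clash
      A , a∈A , A∈F = ∈-concat⁻′ F a∈F
      B , ¬a∈B , B∈F = ∈-concat⁻′ F ¬a∈F
  in A , B , A∈F , B∈F , a , size≤1⇒≈singleton (unit A∈F) a∈A , size≤1⇒≈singleton (unit B∈F) ¬a∈B
  where
  unit : ∀ {A} → A ∈ F → size A ≤ 1
  unit A∈F = ≤-trans (proj₁ (All.lookup F-kcnf A∈F)) k≤1
... | no no-clash = ⊥-elim (⊭0 (All.lookup (chain-sound consistent F-true ch []) 0∈))
  where
  consistent : Consistent (concat F)
  consistent a∈F ¬a∈F = no-clash (lose a∈F ¬a∈F)
  F-true : ∀ {A} → A ∈ F → concat F ⊨ clauseDNF A
  F-true {[]}    A∈F = ⊥-elim (IsKCNF⇒[]∉ F-kcnf A∈F)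
  F-true {a ∷ _} A∈F = [ a ] , here refl , λ { (here refl) → ∈-concat⁺′ (here refl) A∈F }

axiom-width : ∀ {W A} → 1 ≤ W → IsKCNF k F → A ∈ F → size A ≤ W + k ∸ 1
axiom-width {k} {W = W} {A} 1≤W F-kcnf A∈F = begin
  size A    ≤⟨ proj₁ (All.lookup F-kcnf A∈F) ⟩
  k         ≤⟨ m≤n+m k (W ∸ 1) ⟩
  W ∸ 1 + k ≡⟨ +-∸-comm k 1≤W ⟨
  W + k ∸ 1 ∎
  where open ≤-Reasoning

resolve-literal : ∀ {N Y} a (L : Clause) → ResDeriv F w Y → Y ⊆ a ∷ L ++ N →
                  (a ∉ N → ResDeriv F w (negate a ∷ N)) → length L + size N ≤ w →
                  ∃ λ Y′ → ResDeriv F w Y′ × Y′ ⊆ L ++ N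
resolve-literal {N = N} {Y} a L derivY Y⊆a∷L++N _ _ with a ∈? N | a ∈? Y
... | yes a∈N | _       = Y , derivY , ⊆-trans Y⊆a∷L++N (∈-∷⁺ʳ (∈-++⁺ʳ L a∈N) ⊆-refl)
... | no _    | no a∉Y  = Y , derivY , ⊆∷∧∉⇒⊆ Y⊆a∷L++N a∉Y
resolve-literal {F = F} {w} {N} {Y} a L derivY Y⊆a∷L++N refute room | no a∉N | yes a∈Y =
  Y-a ++ N , resolvent , Y-a++N⊆L++N
  where
  Y-a = filter (¬? ∘ (a ≟L_)) Y
  Y≈a∷Y-a : Y ≈L (a ∷ Y-a)
  Y≈a∷Y-a = Y⊆a∷Y-a , λ { (here refl) → a∈Y ; (there b∈Y-a) → proj₁ (∈-filter⁻ (¬? ∘ (a ≟L_)) b∈Y-a) }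
    where
    Y⊆a∷Y-a : Y ⊆ a ∷ Y-a
    Y⊆a∷Y-a {b} b∈Y with a ≟L b
    ... | yes refl = here refl
    ... | no a≢b   = there (∈-filter⁺ (¬? ∘ (a ≟L_)) b∈Y a≢b)
  Y-a⊆L++N : Y-a ⊆ L ++ N
  Y-a⊆L++N b∈Y-a with ∈-filter⁻ (¬? ∘ (a ≟L_)) b∈Y-a
  ... | b∈Y , a≢b with Y⊆a∷L++N b∈Y
  ...   | here b≡a     = ⊥-elim (a≢b (sym b≡a))
  ...   | there b∈L++N = b∈L++N
  Y-a++N⊆L++N : Y-a ++ N ⊆ L ++ N
  Y-a++N⊆L++N = ++-⊆ Y-a⊆L++N (xs⊆ys++xs N L)
  |Y-a++N|≤w : size (Y-a ++ N) ≤ w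
  |Y-a++N|≤w = begin
    size (Y-a ++ N)   ≤⟨ size-mono Y-a++N⊆L++N ⟩
    size (L ++ N)     ≤⟨ size-++ L N ⟩
    size L + size N   ≤⟨ +-monoˡ-≤ (size N) (size≤length L) ⟩
    length L + size N ≤⟨ room ⟩
    w                 ∎
    where open ≤-Reasoning
  resolvent : ResDeriv F w (Y-a ++ N)
  resolvent = resolve a Y-a N derivY (refute a∉N) Y≈a∷Y-a (id , id) (id , id) |Y-a++N|≤w

resolve-away : ∀ {N Y} (L : Clause) → ResDeriv F w Y → Y ⊆ L ++ N →
               (∀ {a} → a ∈ L → a ∉ N → ResDeriv F w (negate a ∷ N)) →
               length L + size N ≤ suc w → size N ≤ w → ResDeriv F w N
resolve-away [] derivY Y⊆N _ _ |N|≤w = weaken derivY Y⊆N |N|≤w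
resolve-away (a ∷ L) derivY Y⊆a∷L++N refute room |N|≤w =
  let _ , derivY′ , Y′⊆L++N = resolve-literal a L derivY Y⊆a∷L++N (refute (here refl)) (s≤s⁻¹ room)
  in resolve-away L derivY′ Y′⊆L++N (refute ∘ there) (≤-trans (n≤1+n _) room) |N|≤w

shrink : All (ρ ⊨[ r ]_) 𝒞 → ∃ λ ρ′ → ρ′ ⊆ ρ × size ρ′ ≤ length 𝒞 * r × All (ρ′ ⊨[ r ]_) 𝒞
shrink [] = [] , (λ ()) , z≤n , []
shrink ((T , T∈P×|T|≤r , T⊆ρ) ∷ ρ⊨𝒞) =
  let ρ′ , ρ′⊆ρ , |ρ′| , ρ′⊨𝒞 = shrink ρ⊨𝒞
  in T ++ ρ′ , ++-⊆ T⊆ρ ρ′⊆ρ , ≤-trans (size-++ T ρ′) (+-mono-≤ (proj₂ T∈P×|T|≤r) |ρ′|) ,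
     (T , T∈P×|T|≤r , xs⊆xs++ys T ρ′) ∷ All.map (⊨[]-mono (xs⊆ys++xs ρ′ T)) ρ′⊨𝒞

module Simulation {F : CNF} {k r s : ℕ} (F-kcnf : IsKCNF k F) (1<k : 1 < k) (1≤r : 1 ≤ r)
                  (1≤W : 1 ≤ (s ∸ 2) * r) where

  W : ℕ
  W = (s ∸ 2) * r

  width : ℕ
  width = W + k ∸ 1

  suc-width : suc width ≡ k + W
  suc-width = begin
    suc (W + k ∸ 1)   ≡⟨ cong suc (+-∸-assoc W (<⇒≤ 1<k)) ⟩
    suc (W + (k ∸ 1)) ≡⟨ +-suc W (k ∸ 1) ⟨
    W + suc (k ∸ 1)   ≡⟨ cong (W +_) (m+[n∸m]≡n (<⇒≤ 1<k)) ⟩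
    W + k             ≡⟨ +-comm W k ⟩
    k + W             ∎
    where open ≡-Reasoning

  W<width : W < width
  W<width = s≤s⁻¹ (subst (2 + W ≤_) (sym suc-width) (+-monoˡ-≤ W 1<k))

  -- The slack of one literal over W is taken up by the literal of a downloaded clause.
  Refutable : Config → Set
  Refutable 𝒞 = ∀ {ρ} → Consistent ρ → size ρ ≤ suc W → All (ρ ⊨[ r ]_) 𝒞 →
                ResDeriv F width (map negate ρ)

  weaken-denial : ρ′ ⊆ ρ → size ρ ≤ suc W → ResDeriv F width (map negate ρ′) →
                  ResDeriv F width (map negate ρ)
  weaken-denial {ρ = ρ} ρ′⊆ρ |ρ| derivation =
    weaken derivation (map⁺ negate ρ′⊆ρ) (≤-trans (size-map negate ρ) (≤-trans |ρ| W<width))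

  refutable-∋0 : [] ∈ 𝒞 → Refutable 𝒞
  refutable-∋0 0∈𝒞 _ _ ρ⊨𝒞 with All.lookup ρ⊨𝒞 0∈𝒞
  ... | _ , (() , _) , _

  refutable-⊆ : 𝒞 ⊆ 𝒞′ → Refutable 𝒞 → Refutable 𝒞′
  refutable-⊆ 𝒞⊆𝒞′ refutable ρ-consistent |ρ| ρ⊨𝒞′ = refutable ρ-consistent |ρ| (anti-mono 𝒞⊆𝒞′ ρ⊨𝒞′)

  refutable-infer : IsRDNF r D → Inference r 𝒞 D → Refutable (D ∷ 𝒞) → Refutable 𝒞
  refutable-infer D-rdnf inf refutable ρ-consistent |ρ| ρ⊨𝒞 =
    let T , T∈D , T⊆ρ = inference-sound ρ-consistent (All.map ⊨[]⇒⊨ ρ⊨𝒞) inf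
    in refutable ρ-consistent |ρ| ((T , (T∈D , All.lookup D-rdnf T∈D) , T⊆ρ) ∷ ρ⊨𝒞)

  refutable-download : ∀ {A} → A ∈ F → 2 + length 𝒞 ≤ s → Refutable (clauseDNF A ∷ 𝒞) → Refutable 𝒞
  refutable-download {𝒞} {A} A∈F room refutable ρ-consistent |ρ| ρ⊨𝒞 with shrink ρ⊨𝒞
  ... | ρ′ , ρ′⊆ρ , |ρ′| , ρ′⊨𝒞 =
    weaken-denial ρ′⊆ρ |ρ|
      (resolve-away (deduplicate _≟L_ A) (axiom A∈F (axiom-width 1≤W F-kcnf A∈F))
                    (xs⊆xs++ys _ N ∘ ⊆-deduplicate A) refute-literal room′ (<⇒≤ (≤-<-trans |N|≤W W<width)))
    where
    N = map negate ρ′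
    |ρ′|≤W : size ρ′ ≤ W
    |ρ′|≤W = ≤-trans |ρ′| (*-monoˡ-≤ r (∸-monoˡ-≤ 2 room))
    |N|≤W : size N ≤ W
    |N|≤W = ≤-trans (size-map negate ρ′) |ρ′|≤W
    room′ : size A + size N ≤ suc width
    room′ = subst (size A + size N ≤_) (sym suc-width) (+-mono-≤ (proj₁ (All.lookup F-kcnf A∈F)) |N|≤W)
    refute-literal : ∀ {a} → a ∈ deduplicate _≟L_ A → a ∉ N → ResDeriv F width (negate a ∷ N)
    refute-literal {a} a∈A a∉N =
      refutable (consistent-∷ (consistent-⊆ ρ′⊆ρ ρ-consistent) ¬a∉ρ′) (≤-trans (size-∷ a ρ′) (s≤s |ρ′|≤W))
                ((([ a ] , (∈-map⁺ [_] (∈-deduplicate⁻ _≟L_ A a∈A) , 1≤r) , λ { (here refl) → here refl })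
                 ∷ All.map (⊨[]-mono (xs⊆x∷xs ρ′ a)) ρ′⊨𝒞))
      where
      ¬a∉ρ′ : negate a ∉ ρ′
      ¬a∉ρ′ ¬a∈ρ′ = a∉N (subst (_∈ N) (negate-involutive a) (∈-map⁺ negate ¬a∈ρ′))

  -- A download that leaves no room must be followed by an erasure; simulating the two steps
  -- together keeps the configuration seen at the download within s − 2 formulas.
  refutable-before-erasure : ∀ {A 𝒞₁ 𝒞₂} → A ∈ F → Step F r 𝒞₁ 𝒞₂ → 𝒞₁ ≡ clauseDNF A ∷ 𝒞 →
                             length 𝒞₁ ≤ s → length 𝒞₂ ≤ length 𝒞₁ → Refutable 𝒞₂ → Refutable 𝒞
  refutable-before-erasure _ (download _ _) _ _ grows = ⊥-elim (1+n≰n grows)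
  refutable-before-erasure _ (infer _ _ _) _ _ grows = ⊥-elim (1+n≰n grows)
  refutable-before-erasure _ (erase [] _ _) refl _ _ = id
  refutable-before-erasure A∈F (erase (_ ∷ xs) _ ys) refl |𝒞₁|≤s _ =
    refutable-⊆ (erase-⊆ xs) ∘ refutable-download A∈F (subst (_≤ s) (cong suc (length-erase xs)) |𝒞₁|≤s)

  refutable-download-or-erasure : ∀ {A 𝒞₂} → A ∈ F → Step F r (clauseDNF A ∷ 𝒞) 𝒞₂ →
                                  length (clauseDNF A ∷ 𝒞) ≤ s → length 𝒞₂ ≤ s →
                                  Refutable (clauseDNF A ∷ 𝒞) → Refutable 𝒞₂ → Refutable 𝒞
  refutable-download-or-erasure {𝒞} A∈F step len len′ refutable₁ refutable₂ with 2 + length 𝒞 ≤? s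
  ... | yes room = refutable-download A∈F room refutable₁
  ... | no full  = refutable-before-erasure A∈F step refl len (≤-trans len′ (≮⇒≥ full)) refutable₂

  refutable-along : Chain F r 𝒞 cs → All (λ 𝒞′ → length 𝒞′ ≤ s) cs → [] ∈ lastConfig 𝒞 cs → Refutable 𝒞
  refutable-along stop _ 0∈ = refutable-∋0 0∈
  refutable-along (next (erase xs _ _) ch) (_ ∷ bounds) 0∈ =
    refutable-⊆ (erase-⊆ xs) (refutable-along ch bounds 0∈)
  refutable-along (next (infer _ D-rdnf inf) ch) (_ ∷ bounds) 0∈ =
    refutable-infer D-rdnf inf (refutable-along ch bounds 0∈)
  refutable-along (next (download _ A∈F) stop) _ 0∈ =
    refutable-∋0 (download-∋[] (IsKCNF⇒[]∉ F-kcnf) A∈F 0∈)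
  refutable-along (next (download _ A∈F) ch@(next step ch′)) (len ∷ bounds@(len′ ∷ bounds′)) 0∈ =
    refutable-download-or-erasure A∈F step len len′ (refutable-along ch bounds 0∈) (refutable-along ch′ bounds′ 0∈)

  refutation : Chain F r [] cs → All (λ 𝒞 → length 𝒞 ≤ s) cs → [] ∈ lastConfig [] cs →
               ResRefutationOfWidth≤ F width
  refutation ch bounds 0∈ = refutable-along ch bounds 0∈ {ρ = []} (λ ()) z≤n []

theorem3p7 : (k r s : ℕ) (F : CNF) → IsKCNF k F →
    (π : DNFRefutation F r) → space π ≤ s →
    ResRefutationOfWidth≤ F ((s ∸ 2) * r + k ∸ 1)
theorem3p7 k r s F F-kcnf π space≤s = by-clause-width (k ≤? 1)
  where
  open DNFRefutation π
  bounds : All (λ 𝒞 → length 𝒞 ≤ s) rest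
  bounds = All.tail (space≤⇒length≤ π space≤s)
  shape = deriving-0⇒1≤r×3≤length (IsKCNF⇒[]∉ F-kcnf) chain (λ ()) refutes
  1≤r = proj₁ shape
  3≤s : 3 ≤ s
  3≤s = All.lookupWith (λ |𝒞|≤s 3≤|𝒞| → ≤-trans 3≤|𝒞| |𝒞|≤s) bounds (proj₂ shape)
  1≤W : 1 ≤ (s ∸ 2) * r
  1≤W = *-mono-≤ (∸-monoˡ-≤ 2 3≤s) 1≤r
  by-clause-width : Dec (k ≤ 1) → ResRefutationOfWidth≤ F ((s ∸ 2) * r + k ∸ 1)
  by-clause-width (yes k≤1) =
    let A , B , A∈F , B∈F , a , A≈[a] , B≈[¬a] = complementary-units k≤1 F-kcnf chain refutes
    in resolve a [] [] (axiom A∈F (axiom-width 1≤W F-kcnf A∈F)) (axiom B∈F (axiom-width 1≤W F-kcnf B∈F))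
               A≈[a] B≈[¬a] ((λ ()) , (λ ())) z≤n
  by-clause-width (no k≰1) = Simulation.refutation F-kcnf (≰⇒> k≰1) 1≤r 1≤W chain bounds refutes
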